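{- If $A\subseteq[N]$ is a multiset and there exists a nonnegative integer $a_0$ such that $a_0+\Sigma^*(A)$ is contained in the set of squarefree numbers, then $|A|\ll(\log N)^2$.
   Context: For a multiset $A$, $\Sigma^*(A)$ is the set of sums over nonempty submultisets; $|A|$ counts multiplicity. $[N]=\{1,\dots,N\}$. The implied constant is absolute. -}

module Defs where

open import Data.Nat using (ℕ; _+_; _*_; _≤_)
open import Data.Nat.Divisibility using (_∣_)
open import Data.List using (List; [])
open import Data.Nat.ListAction using (sum)
open import Data.List.Relation.Binary.Sublist.Propositional using (_⊆_)
open import Data.List.Relation.Unary.All using (All)
open import Data.Product using (_×_)
open import Relation.Binary.PropositionalEquality using (_≡_; _≢_)

-- n is squarefree: the only d with d² ∣ n is d = 1 (so 0 is not squarefree).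
SquareFree : ℕ → Set
SquareFree n = ∀ d → d * d ∣ n → d ≡ 1

-- A multiset with elements in [N] = {1,…,N}, represented as a list.
InRange : ℕ → List ℕ → Set
InRange N A = All (λ a → 1 ≤ a × a ≤ N) A

-- a₀ + Σ*(A) ⊆ squarefree numbers: every sum of a nonempty submultiset
-- (sublist) ys of A, shifted by a₀, is squarefree.
ShiftedSubsetSumsSquareFree : ℕ → List ℕ → Set
ShiftedSubsetSumsSquareFree a₀ A =
  ∀ (ys : List ℕ) → ys ⊆ A → ys ≢ [] → SquareFree (a₀ + sum ys)

{-# OPTIONS --safe #-}
-- Fix a prime u. Elements of A not divisible by u are units modulo u², and the subset sums of more
-- than u² units hit every residue class modulo u², in particular that of -a₀; so squarefreeness
-- of a₀ + Σ*(A) forces every prime u ≤ P to divide all but at most P² elements of A. Multiplying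
-- over these primes, their product Q satisfies Q^|A| ≤ N^|A| Q^(P²), hence |A| ≤ 2P² once N² ≤ Q.
-- Chebyshev's bound Q ≥ 2^(P/4) for P a power of 4, obtained from 2ⁿ ≤ C(2n, n) ≤ (2n)^√(2n) Q
-- via Legendre's formula, then shows that P ≍ log N will do.
module Submission where

open import Defs
open import Data.Nat
open import Data.Nat.Properties
open import Data.Nat.Divisibility
open import Data.Nat.DivMod
open import Data.Nat.Primality
open import Data.Nat.Primality.Factorisation using (factorise)
open import Data.Nat.Coprimality as Coprimality using (Coprime; coprime-Bézout; coprime-divisor)
open import Data.Nat.GCD using (module Bézout)
open import Data.Nat.Induction using (<-rec)
open import Data.Nat.ListAction using (sum; product)
open import Data.Nat.Logarithm using (⌊log₂_⌋; ⌊log₂⌋-mono-≤; ⌊log₂[2^n]⌋≡n)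
open import Data.Nat.Combinatorics using (_C_; nCk+nC[k+1]≡[n+1]C[k+1]; nCk≡nC[n∸k]; k![n∸k]!∣n!)
open import Data.Nat.Combinatorics.Specification using (nCk≡n!/k![n-k]!)
open import Data.List using (List; []; _∷_; length; map; filter)
open import Data.List.Relation.Unary.All as All using (All; []; _∷_)
open import Data.List.Relation.Binary.Sublist.Propositional using (_⊆_; []; _∷_; _∷ʳ_; ⊆-trans)
open import Data.List.Relation.Binary.Sublist.Propositional.Properties using (filter-⊆)
open import Data.List.Relation.Unary.All.Properties using (all-filter)
open import Data.Vec using (Vec; []; _∷_; lookup)
open import Data.Vec.Relation.Unary.All as VAll using ([]; _∷_) renaming (All to VAll)
open import Data.Vec.Relation.Unary.AllPairs using ([]; _∷_)
open import Data.Vec.Relation.Unary.All.Properties using (lookup⁺; lookup⁻)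
open import Data.Vec.Relation.Unary.Any as Any using (Any)
open import Data.Vec.Relation.Unary.Unique.Propositional using (Unique)
open import Data.Vec.Relation.Unary.Unique.Propositional.Properties using (lookup-injective)
open import Data.Vec.Membership.Propositional using (_∈_; _∉_)
open import Data.Vec.Membership.Propositional.Properties using (∈-lookup)
open import Data.Vec.Membership.DecPropositional _≟_ using (_∈?_)
open import Data.Fin using (Fin; zero; toℕ; fromℕ<)
open import Data.Fin.Properties using (injective⇒≤; toℕ-fromℕ<)
open import Function.Definitions using (Injective)
open import Data.Product using (Σ; ∃; ∃₂; _×_; _,_; proj₁; proj₂)
open import Data.Sum using (_⊎_; inj₁; inj₂)
open import Function using (_∘_)
open import Relation.Nullary using (¬_; Dec; yes; no; contradiction)
open import Relation.Unary using (Decidable)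
open import Relation.Nullary.Decidable using (toSum; ¬?)
open import Relation.Binary.PropositionalEquality
open import Data.Nat.Tactic.RingSolver using (solve-∀)
open import Algebra.Properties.CommutativeSemigroup +-commutativeSemigroup
  using () renaming (interchange to +-interchange)
open import Algebra.Properties.CommutativeSemigroup *-commutativeSemigroup
  using () renaming (interchange to *-interchange)

prime≥2 : ∀ {p} → Prime p → 2 ≤ p
prime≥2 {p} pp = nonTrivial⇒n>1 p {{prime⇒nonTrivial pp}}

prime∤1 : ∀ {p} → Prime p → ¬ p ∣ 1
prime∤1 pp p∣1 = ¬prime[1] (subst Prime (∣1⇒≡1 p∣1) pp)

prime∤⇒coprime : ∀ {p n} → Prime p → ¬ p ∣ n → Coprime p n
prime∤⇒coprime pp p∤n {d} (d∣p , d∣n) with prime⇒irreducible pp d∣p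
... | inj₁ d≡1 = d≡1
... | inj₂ refl = contradiction d∣n p∤n

coprime-*ʳ : ∀ {m n o} → Coprime m n → Coprime m o → Coprime m (n * o)
coprime-*ʳ {m} {n} m⊥n m⊥o {d} (d∣m , d∣n*o) = m⊥o (d∣m , coprime-divisor d⊥n d∣n*o)
  where
  d⊥n : Coprime d n
  d⊥n (i∣d , i∣n) = m⊥n (∣-trans i∣d d∣m , i∣n)

coprime-*-∣ : ∀ {m n o} → Coprime m n → m ∣ o → n ∣ o → m * n ∣ o
coprime-*-∣ {m} {n} m⊥n m∣o (divides k refl) =
  *-monoˡ-∣ n (coprime-divisor m⊥n (subst (m ∣_) (*-comm k n) m∣o))

∃-prime-divisor : ∀ n → 2 ≤ n → ∃ λ p → Prime p × p ∣ n
∃-prime-divisor (suc zero) (s≤s ())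
∃-prime-divisor n@(suc (suc _)) _ with factorise n
... | record { factors = [] ; isFactorisation = () }
... | record { factors = p ∷ ps ; isFactorisation = n≡ ; factorsPrime = pp ∷ _ } =
  p , pp , divides (product ps) (trans n≡ (*-comm p (product ps)))

^-distribʳ-* : ∀ m n k → (m * n) ^ k ≡ m ^ k * n ^ k
^-distribʳ-* m n zero = refl
^-distribʳ-* m n (suc k) = trans (cong (m * n *_) (^-distribʳ-* m n k)) (*-interchange m n (m ^ k) (n ^ k))

^-cancelʳ-≤ : ∀ b → 2 ≤ b → ∀ {m n} → b ^ m ≤ b ^ n → m ≤ n
^-cancelʳ-≤ b 2≤b bᵐ≤bⁿ = ≮⇒≥ (λ n<m → <⇒≱ (^-monoʳ-< b 2≤b n<m) bᵐ≤bⁿ)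

^-cancelʳ-< : ∀ b .{{_ : NonZero b}} {m n} → b ^ m < b ^ n → m < n
^-cancelʳ-< b bᵐ<bⁿ = ≰⇒> (λ n≤m → <⇒≱ bᵐ<bⁿ (^-monoʳ-≤ b n≤m))

n<b^n : ∀ b → 2 ≤ b → ∀ n → n < b ^ n
n<b^n b 2≤b zero = s≤s z≤n
n<b^n b 2≤b (suc n) = ≤-<-trans (n<b^n b 2≤b n) (^-monoʳ-< b 2≤b (n<1+n n))

^-monoʳ-∣ : ∀ b {i a} → i ≤ a → b ^ i ∣ b ^ a
^-monoʳ-∣ b {i} {a} i≤a = divides (b ^ (a ∸ i))
  (trans (cong (b ^_) (sym (m∸n+n≡m i≤a))) (^-distribˡ-+-* b (a ∸ i) i))

power-bracket : ∀ b → 2 ≤ b → ∀ x .{{_ : NonZero x}} → ∃ λ j → b ^ j ≤ x × x < b ^ suc j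
power-bracket b 2≤b (suc zero) = 0 , ≤-refl , ≤-trans 2≤b (≤-reflexive (sym (*-identityʳ b)))
power-bracket b 2≤b (suc (suc x)) with j , lo , hi ← power-bracket b 2≤b (suc x) | 2 + x <? b ^ suc j
... | yes below = j , m≤n⇒m≤1+n lo , below
... | no ¬below = suc j , ≮⇒≥ ¬below , ≤-<-trans hi (^-monoʳ-< b 2≤b (n<1+n (suc j)))

p^j∣p^c*u⇒j≤c : ∀ {p u} → Prime p → ¬ p ∣ u → ∀ j c → p ^ j ∣ p ^ c * u → j ≤ c
p^j∣p^c*u⇒j≤c pp p∤u zero c _ = z≤n
p^j∣p^c*u⇒j≤c {p} {u} pp p∤u (suc j) zero p^j∣u =
  contradiction (∣-trans (m∣m*n (p ^ j)) (subst (p ^ suc j ∣_) (*-identityˡ u) p^j∣u)) p∤u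
p^j∣p^c*u⇒j≤c {p} {u} pp p∤u (suc j) (suc c) p^j∣p^c*u = s≤s (p^j∣p^c*u⇒j≤c pp p∤u j c
  (*-cancelˡ-∣ p {{prime⇒nonZero pp}} (subst (p * p ^ j ∣_) (*-assoc p (p ^ c) u) p^j∣p^c*u)))

prime-power-decomposition : ∀ {p} → Prime p → ∀ M → 1 ≤ M → ∃₂ λ a w → M ≡ p ^ a * w × ¬ p ∣ w
prime-power-decomposition {p} pp = <-rec _ decompose
  where
  decompose : ∀ M → (∀ {m} → m < M → 1 ≤ m → ∃₂ λ a w → m ≡ p ^ a * w × ¬ p ∣ w) →
              1 ≤ M → ∃₂ λ a w → M ≡ p ^ a * w × ¬ p ∣ w
  decompose M rec 1≤M with p ∣? M
  ... | no p∤M = 0 , M , sym (+-identityʳ M) , p∤M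
  ... | yes (divides zero refl) = contradiction 1≤M λ ()
  ... | yes (divides m@(suc _) refl) with rec (m<m*n m p (prime≥2 pp)) (s≤s z≤n)
  ...   | a , w , m≡pᵃw , p∤w = suc a , w , mp≡ , p∤w
    where
    mp≡ : m * p ≡ p ^ suc a * w
    mp≡ = begin
      m * p             ≡⟨ *-comm m p ⟩
      p * m             ≡⟨ cong (p *_) m≡pᵃw ⟩
      p * (p ^ a * w)   ≡⟨ *-assoc p (p ^ a) w ⟨
      p ^ suc a * w     ∎
      where open ≡-Reasoning

unique-bounded⇒≤ : ∀ {m q} {R : Vec ℕ m} → Unique R → VAll (_< q) R → m ≤ q
unique-bounded⇒≤ {m} {q} {R} unique bounded = injective⇒≤ toFin-injective
  where
  toFin : Fin m → Fin q
  toFin i = fromℕ< (lookup⁺ bounded i)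
  toFin-injective : Injective _≡_ _≡_ toFin
  toFin-injective {i} {j} eq = lookup-injective unique i j (begin
    lookup R i          ≡⟨ toℕ-fromℕ< (lookup⁺ bounded i) ⟨
    toℕ (toFin i)       ≡⟨ cong toℕ eq ⟩
    toℕ (toFin j)       ≡⟨ toℕ-fromℕ< (lookup⁺ bounded j) ⟩
    lookup R j          ∎)
    where open ≡-Reasoning

-- Adding an element x coprime to q either enlarges the set of residues of subset sums, or that set
-- is closed under r ↦ r + x and hence, x being invertible modulo q, contains every residue.
module SubsetSumResidues (q : ℕ) .{{_ : NonZero q}} where

  +-cong-% : ∀ {a b c d} → a % q ≡ b % q → c % q ≡ d % q → (a + c) % q ≡ (b + d) % q
  +-cong-% {a} {b} {c} {d} a≡b c≡d = begin
    (a + c) % q               ≡⟨ %-distribˡ-+ a c q ⟩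
    (a % q + c % q) % q       ≡⟨ cong₂ (λ u v → (u + v) % q) a≡b c≡d ⟩
    (b % q + d % q) % q       ≡⟨ %-distribˡ-+ b d q ⟨
    (b + d) % q               ∎
    where open ≡-Reasoning

  *-cong-% : ∀ {a b c d} → a % q ≡ b % q → c % q ≡ d % q → (a * c) % q ≡ (b * d) % q
  *-cong-% {a} {b} {c} {d} a≡b c≡d = begin
    (a * c) % q               ≡⟨ %-distribˡ-* a c q ⟩
    (a % q * (c % q)) % q     ≡⟨ cong₂ (λ u v → (u * v) % q) a≡b c≡d ⟩
    (b % q * (d % q)) % q     ≡⟨ %-distribˡ-* b d q ⟨
    (b * d) % q               ∎
    where open ≡-Reasoning

  ∣+pred* : ∀ a → q ∣ a + pred q * a
  ∣+pred* a = subst (q ∣_) (cong (_* a) (sym (suc-pred q))) (m∣m*n a)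

  coprime⇒invertible : ∀ {x} → Coprime x q → ∃ λ t → (t * x) % q ≡ 1 % q
  coprime⇒invertible {x} x⊥q with coprime-Bézout x⊥q
  ... | Bézout.+- a y 1+yq≡ax = a , (begin
    (a * x) % q               ≡⟨ cong (_% q) 1+yq≡ax ⟨
    (1 + y * q) % q           ≡⟨ [m+kn]%n≡m%n 1 y q ⟩
    1 % q                     ∎)
    where open ≡-Reasoning
  ... | Bézout.-+ a y 1+ax≡yq = pred q * a , (begin
    (pred q * a * x) % q                        ≡⟨ [m+kn]%n≡m%n (pred q * a * x) y q ⟨
    (pred q * a * x + y * q) % q                ≡⟨ cong (λ n → (pred q * a * x + n) % q) 1+ax≡yq ⟨
    (pred q * a * x + (1 + a * x)) % q          ≡⟨ cong (_% q) (rearrange (pred q) a x) ⟩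
    (1 + (a * x + pred q * (a * x))) % q        ≡⟨ %-remove-+ʳ 1 (∣+pred* (a * x)) ⟩
    1 % q                                       ∎)
    where
    open ≡-Reasoning
    rearrange : ∀ n a x → n * a * x + (1 + a * x) ≡ 1 + (a * x + n * (a * x))
    rearrange = solve-∀

  SumResidue : List ℕ → ℕ → Set
  SumResidue xs r = ∃ λ zs → zs ⊆ xs × sum zs % q ≡ r

  SumResidue-∷ʳ : ∀ x {xs r} → SumResidue xs r → SumResidue (x ∷ xs) r
  SumResidue-∷ʳ x (zs , zs⊆xs , eq) = zs , x ∷ʳ zs⊆xs , eq

  SumResidue-∷ : ∀ x {xs r} → SumResidue xs r → SumResidue (x ∷ xs) ((r + x) % q)
  SumResidue-∷ x {r = r} (zs , zs⊆xs , eq) = x ∷ zs , refl ∷ zs⊆xs , (begin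
    (x + sum zs) % q          ≡⟨ cong (_% q) (+-comm x (sum zs)) ⟩
    (sum zs + x) % q          ≡⟨ +-cong-% (trans (sym (m%n%n≡m%n (sum zs) q)) (cong (_% q) eq)) refl ⟩
    (r + x) % q               ∎)
    where open ≡-Reasoning

  ShiftClosed : ∀ {m} → ℕ → Vec ℕ m → Set
  ShiftClosed x R = ∀ {r} → r ∈ R → (r + x) % q ∈ R

  shiftClosed-iterate : ∀ {m x r} {R : Vec ℕ m} → ShiftClosed x R → r % q ∈ R →
                        ∀ t → (r + t * x) % q ∈ R
  shiftClosed-iterate {r = r} {R} closed r∈R zero =
    subst (_∈ R) (cong (_% q) (sym (+-identityʳ r))) r∈R
  shiftClosed-iterate {x = x} {r} {R} closed r∈R (suc t) =
    subst (_∈ R) eq (closed (shiftClosed-iterate closed r∈R t))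
    where
    eq : ((r + t * x) % q + x) % q ≡ (r + (x + t * x)) % q
    eq = trans (+-cong-% (m%n%n≡m%n (r + t * x) q) refl)
               (cong (_% q) (trans (+-assoc r (t * x) x) (cong (r +_) (+-comm (t * x) x))))

  shiftClosed⇒complete : ∀ {m x r} {R : Vec ℕ m} → Coprime x q → ShiftClosed x R → r % q ∈ R →
                         ∀ τ → τ % q ∈ R
  shiftClosed⇒complete {x = x} {r} {R} x⊥q closed r∈R τ with coprime⇒invertible x⊥q
  ... | t , tx≡1 = subst (_∈ R) reaches (shiftClosed-iterate closed r∈R (c * t))
    where
    c = τ + pred q * r
    rearrange : ∀ r τ n → r + (τ + n) ≡ τ + (r + n)
    rearrange = solve-∀
    reaches : (r + c * t * x) % q ≡ τ % q
    reaches = begin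
      (r + c * t * x) % q           ≡⟨ cong (λ n → (r + n) % q) (*-assoc c t x) ⟩
      (r + c * (t * x)) % q         ≡⟨ +-cong-% {r} refl (*-cong-% {c} refl tx≡1) ⟩
      (r + c * 1) % q               ≡⟨ cong (λ n → (r + n) % q) (*-identityʳ c) ⟩
      (r + (τ + pred q * r)) % q    ≡⟨ cong (_% q) (rearrange r τ (pred q * r)) ⟩
      (τ + (r + pred q * r)) % q    ≡⟨ %-remove-+ʳ τ (∣+pred* r) ⟩
      τ % q                         ∎
      where open ≡-Reasoning

  Complete : List ℕ → Set
  Complete xs = ∀ τ → SumResidue xs (τ % q)

  record DistinctResidues (xs : List ℕ) : Set where
    field
      {size}    : ℕ
      residues  : Vec ℕ (suc size)
      distinct  : Unique residues
      bounded   : VAll (_< q) residues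
      attained  : VAll (SumResidue xs) residues
      exceeds   : length xs ≤ size

    length<q : length xs < q
    length<q = ≤-trans (s≤s exceeds) (unique-bounded⇒≤ distinct bounded)

  DistinctResidues-∷ : ∀ {x xs} → Coprime x q → DistinctResidues xs →
                       Complete (x ∷ xs) ⊎ DistinctResidues (x ∷ xs)
  DistinctResidues-∷ {x} x⊥q D = extend (VAll.decide (λ r → toSum ((r + x) % q ∈? residues)) residues)
    where
    open DistinctResidues D
    extend : VAll (λ r → (r + x) % q ∈ residues) residues ⊎ Any (λ r → (r + x) % q ∉ residues) residues →
             Complete (x ∷ _) ⊎ DistinctResidues (x ∷ _)
    extend (inj₁ closed) = inj₁ λ τ →
      SumResidue-∷ʳ x (VAll.lookup attained (shiftClosed⇒complete x⊥q (VAll.lookup closed) r₀∈R τ))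
      where
      r₀∈R : lookup residues zero % q ∈ residues
      r₀∈R = subst (_∈ residues) (sym (m<n⇒m%n≡m (lookup⁺ bounded zero))) (∈-lookup zero residues)
    extend (inj₂ escape) = inj₂ record
      { residues = new ∷ residues
      ; distinct = lookup⁻ (λ i new≡ → new∉R (subst (_∈ residues) (sym new≡) (∈-lookup i residues)))
                   ∷ distinct
      ; bounded  = m%n<n (Any.lookup escape + x) q ∷ bounded
      ; attained = SumResidue-∷ x r-attained ∷ VAll.map (SumResidue-∷ʳ x) attained
      ; exceeds  = s≤s exceeds
      }
      where
      new = (Any.lookup escape + x) % q
      r-attained = proj₁ (VAll.lookupAny attained escape)
      new∉R = proj₂ (VAll.lookupAny attained escape)

  complete-or-distinct : ∀ xs → All (λ x → Coprime x q) xs → Complete xs ⊎ DistinctResidues xs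
  complete-or-distinct [] [] = inj₂ record
    { residues = 0 ∷ [] ; distinct = [] ∷ [] ; bounded = 0<q ∷ []
    ; attained = ([] , [] , m<n⇒m%n≡m 0<q) ∷ [] ; exceeds = z≤n }
    where 0<q = >-nonZero⁻¹ q
  complete-or-distinct (x ∷ xs) (x⊥q ∷ xs⊥q) with complete-or-distinct xs xs⊥q
  ... | inj₁ complete = inj₁ (SumResidue-∷ʳ x ∘ complete)
  ... | inj₂ D = DistinctResidues-∷ x⊥q D

  q≤length⇒complete : ∀ xs → All (λ x → Coprime x q) xs → q ≤ length xs → Complete xs
  q≤length⇒complete xs xs⊥q q≤len with complete-or-distinct xs xs⊥q
  ... | inj₁ complete = complete
  ... | inj₂ D = contradiction q≤len (<⇒≱ (DistinctResidues.length<q D))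

  shifted-sum-divisible : ∀ B → All (λ b → Coprime b q) B → q < length B → ∀ a₀ →
                          ∃ λ ys → ys ⊆ B × ys ≢ [] × q ∣ a₀ + sum ys
  -- pred q * a represents the residue of -a.
  shifted-sum-divisible (x ∷ xs) (_ ∷ xs⊥q) (s≤s q≤len) a₀
    with zs , zs⊆xs , sum≡ ← q≤length⇒complete xs xs⊥q q≤len (pred q * (a₀ + x)) =
    x ∷ zs , refl ∷ zs⊆xs , (λ ()) , m%n≡0⇒n∣m _ q (begin
      (a₀ + (x + sum zs)) % q               ≡⟨ cong (_% q) (+-assoc a₀ x (sum zs)) ⟨
      (a₀ + x + sum zs) % q                 ≡⟨ +-cong-% refl sum≡ ⟩
      (a₀ + x + pred q * (a₀ + x)) % q      ≡⟨ n∣m⇒m%n≡0 _ q (∣+pred* (a₀ + x)) ⟩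
      0                                     ∎)
    where open ≡-Reasoning

prime-square-divides-shifted-sum : ∀ {p} → Prime p → ∀ B → All (λ b → ¬ p ∣ b) B → p * p < length B →
                                   ∀ a₀ → ∃ λ ys → ys ⊆ B × ys ≢ [] × p * p ∣ a₀ + sum ys
prime-square-divides-shifted-sum {p} pp B p∤B =
  SubsetSumResidues.shifted-sum-divisible (p * p) {{m*n≢0 p p}} B (All.map coprime p∤B)
  where
  instance _ = prime⇒nonZero pp
  coprime : ∀ {b} → ¬ p ∣ b → Coprime b (p * p)
  coprime p∤b = coprime-*ʳ b⊥p b⊥p
    where b⊥p = Coprimality.sym (prime∤⇒coprime pp p∤b)

_if_ : ∀ {P : Set} → ℕ → Dec P → ℕ
n if yes _ = n
n if no _ = 1

prime∣if⇒∣ : ∀ {P : Set} {u n} (d : Dec P) → Prime u → u ∣ (n if d) → u ∣ n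
prime∣if⇒∣ (yes _) pu u∣n = u∣n
prime∣if⇒∣ (no _) pu u∣1 = contradiction u∣1 (prime∤1 pu)

primeOrOne : ℕ → ℕ
primeOrOne u = u if prime? u

primorial : ℕ → ℕ
primorial zero = 1
primorial (suc v) = primeOrOne (suc v) * primorial v

primeDivisorProduct : ℕ → ℕ → ℕ
primeDivisorProduct zero a = 1
primeDivisorProduct (suc v) a = (primeOrOne (suc v) if (suc v ∣? a)) * primeDivisorProduct v a

prime∤primeDivisorProduct : ∀ {u} → Prime u → ∀ v a → v < u → ¬ u ∣ primeDivisorProduct v a
prime∤primeDivisorProduct pu zero a _ = prime∤1 pu
prime∤primeDivisorProduct pu (suc v) a v<u u∣D
  with euclidsLemma (primeOrOne (suc v) if (suc v ∣? a)) (primeDivisorProduct v a) pu u∣D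
... | inj₁ u∣factor =
  <⇒≱ v<u (∣⇒≤ (prime∣if⇒∣ (prime? (suc v)) pu (prime∣if⇒∣ (suc v ∣? a) pu u∣factor)))
... | inj₂ u∣D′ = prime∤primeDivisorProduct pu v a (<-trans (n<1+n v) v<u) u∣D′

primeDivisorProduct∣ : ∀ v a → primeDivisorProduct v a ∣ a
primeDivisorProduct∣ zero a = 1∣ a
primeDivisorProduct∣ (suc v) a = extend (suc v ∣? a)
  where
  D = primeDivisorProduct v a
  D∣a = primeDivisorProduct∣ v a
  extend : (d : Dec (suc v ∣ a)) → (primeOrOne (suc v) if d) * D ∣ a
  extend (no _) = subst (_∣ a) (sym (*-identityˡ D)) D∣a
  extend (yes u∣a) with prime? (suc v)
  ... | yes pu = coprime-*-∣ (prime∤⇒coprime pu (prime∤primeDivisorProduct pu v a ≤-refl)) u∣a D∣a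
  ... | no _ = subst (_∣ a) (sym (*-identityˡ D)) D∣a

nonMultiples : ℕ → List ℕ → List ℕ
nonMultiples u = filter (λ a → ¬? (u ∣? a))

power-split : ∀ f u A →
  f ^ length A ≡ product (map (λ a → f if (u ∣? a)) A) * f ^ length (nonMultiples u A)
power-split f u [] = refl
power-split f u (a ∷ A) with u ∣? a | power-split f u A
... | yes _ | ih = trans (cong (f *_) ih) (sym (*-assoc f G (f ^ length (nonMultiples u A))))
  where G = product (map (λ a → f if (u ∣? a)) A)
... | no _ | ih = trans (cong (f *_) ih) (shuffle f G (f ^ length (nonMultiples u A)))
  where
  G = product (map (λ a → f if (u ∣? a)) A)
  shuffle : ∀ f g n → f * (g * n) ≡ 1 * g * (f * n)
  shuffle = solve-∀

product-map-* : ∀ (g h : ℕ → ℕ) A →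
  product (map (λ a → g a * h a) A) ≡ product (map g A) * product (map h A)
product-map-* g h [] = refl
product-map-* g h (a ∷ A) = trans (cong (g a * h a *_) (product-map-* g h A)) (*-interchange (g a) (h a) _ _)

primeOrOne-^-mono : ∀ u {m n} → (Prime u → m ≤ n) → primeOrOne u ^ m ≤ primeOrOne u ^ n
primeOrOne-^-mono u {m} {n} m≤n with prime? u
... | yes pu = ^-monoʳ-≤ u {{prime⇒nonZero pu}} (m≤n pu)
... | no _ = ≤-reflexive (trans (^-zeroˡ m) (sym (^-zeroˡ n)))

-- Splitting u ^ |A| as in power-split, the factors for the elements divisible by u are
-- collected into ∏ primeDivisorProduct v a, the remaining ones are bounded by u ^ K.
primorial-double-counting : ∀ A K v → (∀ u → u ≤ v → Prime u → length (nonMultiples u A) ≤ K) →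
  primorial v ^ length A ≤ product (map (primeDivisorProduct v) A) * primorial v ^ K
primorial-double-counting A K zero _ = ≤-reflexive (begin
  1 ^ length A                                  ≡⟨ ^-zeroˡ (length A) ⟩
  1                                             ≡⟨ cong₂ _*_ (product-ones A) (^-zeroˡ K) ⟨
  product (map (primeDivisorProduct 0) A) * 1 ^ K ∎)
  where
  open ≡-Reasoning
  product-ones : ∀ A → product (map (primeDivisorProduct 0) A) ≡ 1
  product-ones [] = refl
  product-ones (a ∷ A) = trans (+-identityʳ _) (product-ones A)
primorial-double-counting A K (suc v) few = begin
  (f * pv) ^ k                       ≡⟨ ^-distribʳ-* f pv k ⟩
  f ^ k * pv ^ k                     ≡⟨ cong (_* pv ^ k) (power-split f u A) ⟩
  G * f ^ n * pv ^ k                 ≤⟨ *-mono-≤ (*-monoʳ-≤ G (primeOrOne-^-mono u (few u ≤-refl))) ih ⟩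
  G * f ^ K * (E * pv ^ K)           ≡⟨ *-interchange G (f ^ K) E (pv ^ K) ⟩
  G * E * (f ^ K * pv ^ K)           ≡⟨ cong₂ _*_ (product-map-* _ _ A) (^-distribʳ-* f pv K) ⟨
  product (map (primeDivisorProduct u) A) * (f * pv) ^ K ∎
  where
  open ≤-Reasoning
  u = suc v
  f = primeOrOne u
  pv = primorial v
  k = length A
  n = length (nonMultiples u A)
  G = product (map (λ a → f if (u ∣? a)) A)
  E = product (map (primeDivisorProduct v) A)
  ih = primorial-double-counting A K v (λ w w≤v → few w (m≤n⇒m≤1+n w≤v))

product-primeDivisorProduct≤ : ∀ N v A → InRange N A →
                               product (map (primeDivisorProduct v) A) ≤ N ^ length A
product-primeDivisorProduct≤ N v [] [] = ≤-refl
product-primeDivisorProduct≤ N v (a ∷ A) ((1≤a , a≤N) ∷ inRange) =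
  *-mono-≤ (≤-trans (∣⇒≤ {{>-nonZero 1≤a}} (primeDivisorProduct∣ v a)) a≤N)
           (product-primeDivisorProduct≤ N v A inRange)

length-nonMultiples≤ : ∀ a₀ A → ShiftedSubsetSumsSquareFree a₀ A →
                       ∀ {u} → Prime u → length (nonMultiples u A) ≤ u * u
length-nonMultiples≤ a₀ A squarefree {u} pu with length (nonMultiples u A) ≤? u * u
... | yes few = few
... | no many
  with ys , ys⊆B , ys≢[] , u²∣
         ← prime-square-divides-shifted-sum pu (nonMultiples u A) (all-filter _ A) (≰⇒> many) a₀ =
  contradiction (squarefree ys (⊆-trans ys⊆B (filter-⊆ _ A)) ys≢[] u u²∣)
                (nonTrivial⇒≢1 {{prime⇒nonTrivial pu}})

indicator : ∀ {P : Set} → Dec P → ℕ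
indicator (yes _) = 1
indicator (no _) = 0

sumUpTo : (ℕ → ℕ) → ℕ → ℕ
sumUpTo f zero = 0
sumUpTo f (suc K) = f (suc K) + sumUpTo f K

sumUpTo-distrib-+ : ∀ f g K → sumUpTo (λ i → f i + g i) K ≡ sumUpTo f K + sumUpTo g K
sumUpTo-distrib-+ f g zero = refl
sumUpTo-distrib-+ f g (suc K) =
  trans (cong (f (suc K) + g (suc K) +_) (sumUpTo-distrib-+ f g K))
        (+-interchange (f (suc K)) (g (suc K)) (sumUpTo f K) (sumUpTo g K))

sumUpTo-mono-≤ : ∀ {f g} → (∀ i → f i ≤ g i) → ∀ K → sumUpTo f K ≤ sumUpTo g K
sumUpTo-mono-≤ f≤g zero = z≤n
sumUpTo-mono-≤ f≤g (suc K) = +-mono-≤ (f≤g (suc K)) (sumUpTo-mono-≤ f≤g K)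

countUpTo : ∀ {P : ℕ → Set} → Decidable P → ℕ → ℕ
countUpTo P? = sumUpTo (λ i → indicator (P? i))

countUpTo≤ : ∀ {P : ℕ → Set} (P? : Decidable P) K → countUpTo P? K ≤ K
countUpTo≤ P? zero = z≤n
countUpTo≤ P? (suc K) with P? (suc K)
... | yes _ = s≤s (countUpTo≤ P? K)
... | no _ = m≤n⇒m≤1+n (countUpTo≤ P? K)

multiples : ℕ → ℕ → ℕ
multiples q = countUpTo (q ∣?_)

multiples-floor : ∀ q .{{_ : NonZero q}} m → multiples q m * q ≤ m × m < suc (multiples q m) * q
multiples-floor q zero = z≤n , subst (0 <_) (sym (+-identityʳ q)) (>-nonZero⁻¹ q)
multiples-floor q (suc m) with multiples-floor q m | q ∣? suc m
... | lo , hi | yes (divides d 1+m≡dq) =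
  ≤-reflexive (sym 1+m≡[1+c]q) , subst (_< suc (suc c) * q) (sym 1+m≡[1+c]q) (*-monoˡ-< q (n<1+n (suc c)))
  where
  c = multiples q m
  d≡1+c : d ≡ suc c
  d≡1+c = ≤-antisym (*-cancelʳ-≤ d (suc c) q (≤-trans (≤-reflexive (sym 1+m≡dq)) hi))
                    (*-cancelʳ-< q c d (≤-trans (s≤s lo) (≤-reflexive 1+m≡dq)))
  1+m≡[1+c]q : suc m ≡ suc c * q
  1+m≡[1+c]q = trans 1+m≡dq (cong (_* q) d≡1+c)
... | lo , hi | no q∤1+m = m≤n⇒m≤1+n lo , ≤∧≢⇒< hi (λ 1+m≡ → q∤1+m (divides (suc (multiples q m)) 1+m≡))

multiples-double : ∀ q .{{_ : NonZero q}} n →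
                   multiples q (n + n) ≤ multiples q n + multiples q n + indicator (q ≤? n + n)
multiples-double q n with multiples-floor q n | multiples-floor q (n + n) | q ≤? n + n
... | _ , hi | lo₂ , _ | yes _ = subst (b ≤_) (+-comm 1 (a + a)) (≤-pred b<2+2a)
  where
  open ≤-Reasoning
  a = multiples q n
  b = multiples q (n + n)
  bq<[2+2a]q : b * q < (suc a + suc a) * q
  bq<[2+2a]q = begin-strict
    b * q                       ≤⟨ lo₂ ⟩
    n + n                       <⟨ +-mono-< hi hi ⟩
    suc a * q + suc a * q       ≡⟨ *-distribʳ-+ q (suc a) (suc a) ⟨
    (suc a + suc a) * q         ∎
  b<2+2a : b < suc (suc (a + a))
  b<2+2a = subst (b <_) (cong suc (+-suc a a)) (*-cancelʳ-< q b (suc a + suc a) bq<[2+2a]q)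
... | _ | lo₂ , _ | no q≰2n = subst (_≤ multiples q n + multiples q n + 0) (sym b≡0) z≤n
  where
  b = multiples q (n + n)
  b≡0 : b ≡ 0
  b≡0 = n<1⇒n≡0 (*-cancelʳ-< q b 1 (subst (b * q <_) (sym (+-identityʳ q)) (≤-<-trans lo₂ (≰⇒> q≰2n))))

central-binomial-identity : ∀ n → ((n + n) C n) * (n ! * n !) ≡ (n + n) !
central-binomial-identity n = begin
  ((n + n) C n) * (n ! * n !)                 ≡⟨ cong (λ k → ((n + n) C n) * (n ! * k !)) (m+n∸m≡n n n) ⟨
  ((n + n) C n) * (n ! * (n + n ∸ n) !)       ≡⟨ cong (_* (n ! * (n + n ∸ n) !)) (nCk≡n!/k![n-k]! n≤2n) ⟩
  (n + n) ! / (n ! * (n + n ∸ n) !) * (n ! * (n + n ∸ n) !)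
                                              ≡⟨ m/n*n≡m (k![n∸k]!∣n! n≤2n) ⟩
  (n + n) !                                   ∎
  where
  open ≡-Reasoning
  n≤2n = m≤m+n n n
  instance _ = n !* (n + n ∸ n) !≢0

2^n≤central-binomial : ∀ n → 2 ^ n ≤ (n + n) C n
2^n≤central-binomial zero = ≤-refl
2^n≤central-binomial (suc n) = begin
  2 ^ n + (2 ^ n + 0)                   ≡⟨ cong (2 ^ n +_) (+-identityʳ (2 ^ n)) ⟩
  2 ^ n + 2 ^ n                         ≤⟨ +-mono-≤ (subst (2 ^ n ≤_) (sym middle-symmetric) ih′) ih′ ⟩
  suc S C n + suc S C suc n             ≡⟨ nCk+nC[k+1]≡[n+1]C[k+1] (suc S) n ⟩
  suc (suc S) C suc n                   ≡⟨ cong (λ k → suc k C suc n) (+-suc n n) ⟨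
  (suc n + suc n) C suc n               ∎
  where
  open ≤-Reasoning
  S = n + n
  ih′ : 2 ^ n ≤ suc S C suc n
  ih′ = ≤-trans (2^n≤central-binomial n)
                (≤-trans (m≤m+n (S C n) (S C suc n)) (≤-reflexive (nCk+nC[k+1]≡[n+1]C[k+1] S n)))
  middle-symmetric : suc S C n ≡ suc S C suc n
  middle-symmetric = trans (nCk≡nC[n∸k] (m≤n⇒m≤1+n (m≤m+n n n)))
                           (cong (suc S C_) (trans (+-∸-assoc 1 (m≤m+n n n)) (cong suc (m+n∸m≡n n n))))

-- multiples q m = ⌊m / q⌋ (multiples-floor), so legendre K m is Legendre's formula for the exponent
-- of p in m!, truncated at p ^ K.
module Legendre {p : ℕ} (pp : Prime p) where

  private instance
    p≢0 : NonZero p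
    p≢0 = prime⇒nonZero pp

  2≤p = prime≥2 pp

  legendre : ℕ → ℕ → ℕ
  legendre K m = sumUpTo (λ i → multiples (p ^ i) m) K

  legendre-zero : ∀ K → legendre K 0 ≡ 0
  legendre-zero zero = refl
  legendre-zero (suc K) = legendre-zero K

  legendre-suc : ∀ K m → legendre K (suc m) ≡ countUpTo (λ i → p ^ i ∣? suc m) K + legendre K m
  legendre-suc K m = sumUpTo-distrib-+ (λ i → indicator (p ^ i ∣? suc m)) (λ i → multiples (p ^ i) m) K

  legendre-double : ∀ K n →
    legendre K (n + n) ≤ legendre K n + legendre K n + countUpTo (λ i → p ^ i ≤? n + n) K
  legendre-double K n = begin
    legendre K (n + n)
      ≤⟨ sumUpTo-mono-≤ (λ i → multiples-double (p ^ i) {{m^n≢0 p i}} n) K ⟩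
    sumUpTo (λ i → a i + a i + indicator (p ^ i ≤? n + n)) K
                                                        ≡⟨ sumUpTo-distrib-+ (λ i → a i + a i) _ K ⟩
    sumUpTo (λ i → a i + a i) K + countUpTo (λ i → p ^ i ≤? n + n) K
                                                        ≡⟨ cong (_+ countUpTo _ K) (sumUpTo-distrib-+ a a K) ⟩
    legendre K n + legendre K n + countUpTo (λ i → p ^ i ≤? n + n) K ∎
    where
    open ≤-Reasoning
    a = λ i → multiples (p ^ i) n

  count-divisor-powers : ∀ x a → (∀ i → p ^ i ∣ x → i ≤ a) → p ^ a ∣ x →
                         ∀ K → countUpTo (λ i → p ^ i ∣? x) K ≡ K ⊓ a
  count-divisor-powers x a maximal p^a∣x zero = refl
  count-divisor-powers x a maximal p^a∣x (suc K) with p ^ suc K ∣? x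
  ... | yes p^K+1∣x = trans (cong suc (count-divisor-powers x a maximal p^a∣x K))
                            (trans (cong suc (m≤n⇒m⊓n≡m K≤a)) (sym (m≤n⇒m⊓n≡m K+1≤a)))
    where
    K+1≤a = maximal (suc K) p^K+1∣x
    K≤a = ≤-trans (n≤1+n K) K+1≤a
  ... | no p^K+1∤x = trans (count-divisor-powers x a maximal p^a∣x K)
                           (trans (m≥n⇒m⊓n≡n a≤K) (sym (m≥n⇒m⊓n≡n (m≤n⇒m≤1+n a≤K))))
    where
    a≤K : a ≤ K
    a≤K = ≮⇒≥ (λ K<a → p^K+1∤x (∣-trans (^-monoʳ-∣ p K<a) p^a∣x))

  factorial-decomposition : ∀ K m → m < p ^ suc K → ∃ λ u → m ! ≡ p ^ legendre K m * u × ¬ p ∣ u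
  factorial-decomposition K zero _ = 1 , cong (λ e → p ^ e * 1) (sym (legendre-zero K)) , prime∤1 pp
  factorial-decomposition K (suc m) m<p^K+1
    with u , m!≡ , p∤u ← factorial-decomposition K m (<-trans (n<1+n m) m<p^K+1)
       | a , w , suc-m≡ , p∤w ← prime-power-decomposition pp (suc m) (s≤s z≤n)
    = w * u , suc-m!≡ , p∤wu
    where
    p^a∣suc-m : p ^ a ∣ suc m
    p^a∣suc-m = divides w (trans suc-m≡ (*-comm (p ^ a) w))
    maximal : ∀ i → p ^ i ∣ suc m → i ≤ a
    maximal i p^i∣ = p^j∣p^c*u⇒j≤c pp p∤w i a (subst (p ^ i ∣_) suc-m≡ p^i∣)
    a≤K : a ≤ K
    a≤K = ≤-pred (^-cancelʳ-< p (≤-<-trans (∣⇒≤ p^a∣suc-m) m<p^K+1))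
    count≡a : countUpTo (λ i → p ^ i ∣? suc m) K ≡ a
    count≡a = trans (count-divisor-powers (suc m) a maximal p^a∣suc-m K) (m≥n⇒m⊓n≡n a≤K)
    L = legendre K m
    suc-m!≡ : suc m ! ≡ p ^ legendre K (suc m) * (w * u)
    suc-m!≡ = begin
      suc m * m !                       ≡⟨ cong₂ _*_ suc-m≡ m!≡ ⟩
      (p ^ a * w) * (p ^ L * u)         ≡⟨ *-interchange (p ^ a) w (p ^ L) u ⟩
      (p ^ a * p ^ L) * (w * u)         ≡⟨ cong (_* (w * u)) (^-distribˡ-+-* p a L) ⟨
      p ^ (a + L) * (w * u)             ≡⟨ cong (λ e → p ^ (e + L) * (w * u)) count≡a ⟨
      p ^ (countUpTo (λ i → p ^ i ∣? suc m) K + L) * (w * u)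
                                        ≡⟨ cong (λ e → p ^ e * (w * u)) (legendre-suc K m) ⟨
      p ^ legendre K (suc m) * (w * u)  ∎
      where open ≡-Reasoning
    p∤wu : ¬ p ∣ w * u
    p∤wu p∣wu with euclidsLemma w u pp p∣wu
    ... | inj₁ p∣w = p∤w p∣w
    ... | inj₂ p∣u = p∤u p∣u

  power-count≤ : ∀ m → 1 ≤ m → ∀ K → p ^ countUpTo (λ i → p ^ i ≤? m) K ≤ m
  power-count≤ m 1≤m zero = 1≤m
  power-count≤ m 1≤m (suc K) with p ^ suc K ≤? m
  ... | yes p^K+1≤m = ≤-trans (^-monoʳ-≤ p (s≤s (countUpTo≤ (λ i → p ^ i ≤? m) K))) p^K+1≤m
  ... | no _ = power-count≤ m 1≤m K

  m<p^m+1 : ∀ m → m < p ^ suc m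
  m<p^m+1 m = <-trans (n<b^n p 2≤p m) (^-monoʳ-< p 2≤p (n<1+n m))

  central-binomial-prime-power≤ : ∀ n → 1 ≤ n → ∀ j → p ^ j ∣ (n + n) C n → p ^ j ≤ n + n
  central-binomial-prime-power≤ n 1≤n j p^j∣C
    with c , u₀ , C≡ , p∤u₀ ← prime-power-decomposition pp ((n + n) C n)
                                 (≤-trans (m^n>0 2 n) (2^n≤central-binomial n))
       | u₁ , n!≡ , _ ← factorial-decomposition (n + n) n (≤-<-trans (m≤m+n n n) (m<p^m+1 (n + n)))
       | u₂ , 2n!≡ , p∤u₂ ← factorial-decomposition (n + n) (n + n) (m<p^m+1 (n + n))
    = begin
      p ^ j                                         ≤⟨ ^-monoʳ-≤ p (≤-trans j≤c c≤e) ⟩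
      p ^ countUpTo (λ i → p ^ i ≤? n + n) K        ≤⟨ power-count≤ K (≤-trans 1≤n (m≤m+n n n)) K ⟩
      n + n                                         ∎
    where
    open ≤-Reasoning
    K = n + n
    Lₙ = legendre K n
    L₂ₙ = legendre K K
    factorials : p ^ L₂ₙ * u₂ ≡ p ^ (c + (Lₙ + Lₙ)) * (u₀ * (u₁ * u₁))
    factorials = begin-equality
      p ^ L₂ₙ * u₂                                  ≡⟨ 2n!≡ ⟨
      K !                                           ≡⟨ central-binomial-identity n ⟨
      (K C n) * (n ! * n !)                         ≡⟨ cong₂ (λ x y → x * (y * y)) C≡ n!≡ ⟩
      (p ^ c * u₀) * ((p ^ Lₙ * u₁) * (p ^ Lₙ * u₁))
        ≡⟨ cong ((p ^ c * u₀) *_) (*-interchange (p ^ Lₙ) u₁ (p ^ Lₙ) u₁) ⟩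
      (p ^ c * u₀) * ((p ^ Lₙ * p ^ Lₙ) * (u₁ * u₁)) ≡⟨ *-interchange (p ^ c) u₀ _ _ ⟩
      (p ^ c * (p ^ Lₙ * p ^ Lₙ)) * (u₀ * (u₁ * u₁))
        ≡⟨ cong (λ x → (p ^ c * x) * (u₀ * (u₁ * u₁))) (^-distribˡ-+-* p Lₙ Lₙ) ⟨
      (p ^ c * p ^ (Lₙ + Lₙ)) * (u₀ * (u₁ * u₁))
        ≡⟨ cong (_* (u₀ * (u₁ * u₁))) (^-distribˡ-+-* p c (Lₙ + Lₙ)) ⟨
      p ^ (c + (Lₙ + Lₙ)) * (u₀ * (u₁ * u₁))        ∎
    c+2Lₙ≤L₂ₙ : c + (Lₙ + Lₙ) ≤ L₂ₙ
    c+2Lₙ≤L₂ₙ = p^j∣p^c*u⇒j≤c pp p∤u₂ _ L₂ₙ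
      (divides (u₀ * (u₁ * u₁)) (trans factorials (*-comm (p ^ (c + (Lₙ + Lₙ))) _)))
    c≤e : c ≤ countUpTo (λ i → p ^ i ≤? n + n) K
    c≤e = +-cancelˡ-≤ (Lₙ + Lₙ) c _ (begin
      Lₙ + Lₙ + c                                   ≡⟨ +-comm (Lₙ + Lₙ) c ⟩
      c + (Lₙ + Lₙ)                                 ≤⟨ c+2Lₙ≤L₂ₙ ⟩
      L₂ₙ                                           ≤⟨ legendre-double K n ⟩
      Lₙ + Lₙ + countUpTo (λ i → p ^ i ≤? n + n) K  ∎)
    j≤c : j ≤ c
    j≤c = p^j∣p^c*u⇒j≤c pp p∤u₀ j c (subst (p ^ j ∣_) C≡ p^j∣C)

-- For u > s the bound uᵃ ≤ P ≤ s² < u² forces a ≤ 1, so uᵃ costs a factor P only when u ≤ s.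
prime-power-factor≤ : ∀ P s v a → suc v ^ a ≤ P → P ≤ s * s →
                      suc v ^ a * P ^ (v ⊓ s) ≤ P ^ (suc v ⊓ s) * suc v
prime-power-factor≤ P s v a uᵃ≤P P≤s² with suc v ≤? s
... | yes u≤s = begin
  u ^ a * P ^ (v ⊓ s)               ≤⟨ *-monoˡ-≤ (P ^ (v ⊓ s)) uᵃ≤P ⟩
  P * P ^ (v ⊓ s)                   ≡⟨ cong (λ e → P * P ^ e) (m≤n⇒m⊓n≡m (≤-trans (n≤1+n v) u≤s)) ⟩
  P ^ suc v                         ≤⟨ m≤m*n (P ^ suc v) u ⟩
  P ^ suc v * u                     ≡⟨ cong (λ e → P ^ e * u) (m≤n⇒m⊓n≡m u≤s) ⟨
  P ^ (suc v ⊓ s) * u               ∎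
  where
  open ≤-Reasoning
  u = suc v
... | no u≰s = begin
  u ^ a * P ^ (v ⊓ s)               ≤⟨ *-monoˡ-≤ (P ^ (v ⊓ s)) (≤-trans (^-monoʳ-≤ u a≤1) (≤-reflexive (*-identityʳ u))) ⟩
  u * P ^ (v ⊓ s)                   ≡⟨ *-comm u _ ⟩
  P ^ (v ⊓ s) * u                   ≡⟨ cong (λ e → P ^ e * u) (trans (m≥n⇒m⊓n≡n s≤v) (sym (m≥n⇒m⊓n≡n s≤1+v))) ⟩
  P ^ (suc v ⊓ s) * u               ∎
  where
  open ≤-Reasoning
  u = suc v
  s≤v = ≤-pred (≰⇒> u≰s)
  s≤1+v = m≤n⇒m≤1+n s≤v
  a≤1 : a ≤ 1
  a≤1 = ≮⇒≥ λ 1<a → ≤⇒≯ P≤s² (begin-strict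
    s * s                           <⟨ *-mono-< (s≤s s≤v) (s≤s s≤v) ⟩
    u * u                           ≡⟨ cong (u *_) (*-identityʳ u) ⟨
    u ^ 2                           ≤⟨ ^-monoʳ-≤ u 1<a ⟩
    u ^ a                           ≤⟨ uᵃ≤P ⟩
    P                               ∎)

bounded-prime-powers⇒≤ : ∀ P .{{_ : NonZero P}} s → P ≤ s * s → ∀ v M → 1 ≤ M →
  (∀ r j → Prime r → r ^ j ∣ M → r ^ j ≤ P) → (∀ r → Prime r → r ∣ M → r ≤ v) →
  M ≤ P ^ (v ⊓ s) * primorial v
bounded-prime-powers⇒≤ P s P≤s² zero M 1≤M powers≤ divisors≤ with M ≤? 1
... | yes M≤1 = M≤1
... | no M≰1 with r , pr , r∣M ← ∃-prime-divisor M (≰⇒> M≰1) =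
  contradiction (divisors≤ r pr r∣M) (<⇒≱ (≤-trans (s≤s z≤n) (prime≥2 pr)))
bounded-prime-powers⇒≤ P s P≤s² (suc v) M 1≤M powers≤ divisors≤ with prime? (suc v)
... | no ¬pu = begin
  M                                 ≤⟨ bounded-prime-powers⇒≤ P s P≤s² v M 1≤M powers≤ divisors≤v ⟩
  P ^ (v ⊓ s) * primorial v
    ≤⟨ *-mono-≤ (^-monoʳ-≤ P (⊓-monoˡ-≤ s (n≤1+n v))) (≤-reflexive (sym (*-identityˡ _))) ⟩
  P ^ (suc v ⊓ s) * (1 * primorial v) ∎
  where
  open ≤-Reasoning
  divisors≤v : ∀ r → Prime r → r ∣ M → r ≤ v
  divisors≤v r pr r∣M = ≤-pred (≤∧≢⇒< (divisors≤ r pr r∣M) (λ { refl → ¬pu pr }))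
... | yes pu with a , w , M≡ , u∤w ← prime-power-decomposition pu M 1≤M = begin
  M                                 ≡⟨ M≡ ⟩
  u ^ a * w                         ≤⟨ *-monoʳ-≤ (u ^ a) w≤ ⟩
  u ^ a * (P ^ (v ⊓ s) * primorial v) ≡⟨ *-assoc (u ^ a) _ _ ⟨
  u ^ a * P ^ (v ⊓ s) * primorial v
    ≤⟨ *-monoˡ-≤ (primorial v) (prime-power-factor≤ P s v a (powers≤ u a pu uᵃ∣M) P≤s²) ⟩
  P ^ (suc v ⊓ s) * u * primorial v ≡⟨ *-assoc (P ^ (suc v ⊓ s)) u _ ⟩
  P ^ (suc v ⊓ s) * (u * primorial v) ∎
  where
  open ≤-Reasoning
  u = suc v
  uᵃ∣M : u ^ a ∣ M
  uᵃ∣M = divides w (trans M≡ (*-comm (u ^ a) w))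
  w∣M : w ∣ M
  w∣M = divides (u ^ a) M≡
  1≤w : 1 ≤ w
  1≤w = n≢0⇒n>0 λ { refl → contradiction (trans M≡ (*-zeroʳ (u ^ a))) (≢-nonZero⁻¹ M {{>-nonZero 1≤M}}) }
  w≤ : w ≤ P ^ (v ⊓ s) * primorial v
  w≤ = bounded-prime-powers⇒≤ P s P≤s² v w 1≤w
    (λ r j pr rʲ∣w → powers≤ r j pr (∣-trans rʲ∣w w∣M))
    (λ r pr r∣w → ≤-pred (≤∧≢⇒< (divisors≤ r pr (∣-trans r∣w w∣M)) (λ { refl → u∤w r∣w })))

central-binomial≤ : ∀ n s → 1 ≤ n → n + n ≤ s * s → (n + n) C n ≤ (n + n) ^ s * primorial (n + n)
central-binomial≤ n s 1≤n 2n≤s² = begin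
  (n + n) C n
    ≤⟨ bounded-prime-powers⇒≤ (n + n) s 2n≤s² (n + n) ((n + n) C n) 1≤C powers≤ divisors≤ ⟩
  (n + n) ^ ((n + n) ⊓ s) * primorial (n + n)
    ≤⟨ *-monoˡ-≤ (primorial (n + n)) (^-monoʳ-≤ (n + n) (m⊓n≤n (n + n) s)) ⟩
  (n + n) ^ s * primorial (n + n)                 ∎
  where
  open ≤-Reasoning
  instance _ = >-nonZero (≤-trans 1≤n (m≤m+n n n))
  1≤C = ≤-trans (m^n>0 2 n) (2^n≤central-binomial n)
  powers≤ : ∀ r j → Prime r → r ^ j ∣ (n + n) C n → r ^ j ≤ n + n
  powers≤ r j pr = Legendre.central-binomial-prime-power≤ pr n 1≤n j
  divisors≤ : ∀ r → Prime r → r ∣ (n + n) C n → r ≤ n + n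
  divisors≤ r pr r∣C =
    subst (_≤ n + n) (*-identityʳ r) (powers≤ r 1 pr (subst (_∣ (n + n) C n) (sym (*-identityʳ r)) r∣C))

4[1+j]≤2^j : ∀ j → 5 ≤ j → 4 * suc j ≤ 2 ^ j
4[1+j]≤2^j j 5≤j with k , refl ← m≤n⇒∃[o]m+o≡n 5≤j = go k
  where
  go : ∀ k → 4 * suc (5 + k) ≤ 2 ^ (5 + k)
  go zero = ≤ᵇ⇒≤ 24 32 _
  go (suc k) = begin
    4 * suc (6 + k)                     ≡⟨ *-suc 4 (6 + k) ⟩
    4 + 4 * (6 + k)                     ≤⟨ +-mono-≤ (≤-trans (m≤m*n 4 (6 + k)) (go k)) (go k) ⟩
    2 ^ (5 + k) + 2 ^ (5 + k)           ≡⟨ cong (2 ^ (5 + k) +_) (+-identityʳ _) ⟨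
    2 ^ (6 + k)                         ∎
    where open ≤-Reasoning

4^m≡2^m*2^m : ∀ m → 4 ^ m ≡ 2 ^ m * 2 ^ m
4^m≡2^m*2^m = ^-distribʳ-* 2 2

primorial-lower-bound : ∀ j → 5 ≤ j → 2 ^ (4 ^ j) ≤ primorial (4 ^ suc j)
primorial-lower-bound j 5≤j = *-cancelˡ-≤ (2 ^ X) {{m^n≢0 2 X}} (begin
  2 ^ X * 2 ^ X                             ≡⟨ ^-distribˡ-+-* 2 X X ⟨
  2 ^ n                                     ≤⟨ 2^n≤central-binomial n ⟩
  (n + n) C n                               ≤⟨ central-binomial≤ n s 1≤n (≤-reflexive 2n≡s²) ⟩
  (n + n) ^ s * primorial (n + n)           ≡⟨ cong (λ P → P ^ s * primorial P) 2n≡4^[1+j] ⟩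
  (4 ^ suc j) ^ s * primorial (4 ^ suc j)   ≤⟨ *-monoˡ-≤ (primorial (4 ^ suc j)) P^s≤2^X ⟩
  2 ^ X * primorial (4 ^ suc j)             ∎)
  where
  open ≤-Reasoning
  X = 4 ^ j
  n = X + X
  s = 2 ^ suc j
  1≤n = ≤-trans (m^n>0 4 j) (m≤m+n X X)
  2n≡4^[1+j] : n + n ≡ 4 ^ suc j
  2n≡4^[1+j] = four-halves X
    where
    four-halves : ∀ x → (x + x) + (x + x) ≡ 4 * x
    four-halves = solve-∀
  2n≡s² : n + n ≡ s * s
  2n≡s² = trans 2n≡4^[1+j] (4^m≡2^m*2^m (suc j))
  e = suc j * s
  e+e≤X : e + e ≤ X
  e+e≤X = begin
    e + e                                   ≡⟨ regroup (suc j) (2 ^ j) ⟩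
    4 * suc j * 2 ^ j                       ≤⟨ *-monoˡ-≤ (2 ^ j) (4[1+j]≤2^j j 5≤j) ⟩
    2 ^ j * 2 ^ j                           ≡⟨ 4^m≡2^m*2^m j ⟨
    X                                       ∎
    where
    regroup : ∀ i t → i * (2 * t) + i * (2 * t) ≡ 4 * i * t
    regroup = solve-∀
  P^s≤2^X : (4 ^ suc j) ^ s ≤ 2 ^ X
  P^s≤2^X = begin
    (4 ^ suc j) ^ s                         ≡⟨ ^-*-assoc 4 (suc j) s ⟩
    4 ^ e                                   ≡⟨ 4^m≡2^m*2^m e ⟩
    2 ^ e * 2 ^ e                           ≡⟨ ^-distribˡ-+-* 2 e e ⟨
    2 ^ (e + e)                             ≤⟨ ^-monoʳ-≤ 2 e+e≤X ⟩
    2 ^ X                                   ∎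

log₂-bracket : ∀ N → 2 ≤ N → 1 ≤ ⌊log₂ N ⌋ × N < 2 ^ suc ⌊log₂ N ⌋
log₂-bracket N@(suc _) 2≤N with j , 2ʲ≤N , N<2ʲ⁺¹ ← power-bracket 2 ≤-refl N =
  ⌊log₂⌋-mono-≤ 2≤N , <-≤-trans N<2ʲ⁺¹ (^-monoʳ-≤ 2 (s≤s j≤ℓ))
  where
  j≤ℓ : j ≤ ⌊log₂ N ⌋
  j≤ℓ = subst (_≤ ⌊log₂ N ⌋) (⌊log₂[2^n]⌋≡n j) (⌊log₂⌋-mono-≤ 2ʲ≤N)

exponent-bound : ∀ Q N k K → 2 ≤ Q → N * N ≤ Q → Q ^ k ≤ N ^ k * Q ^ K → k ≤ K + K
exponent-bound Q N k K 2≤Q N²≤Q Qᵏ≤ = +-cancelˡ-≤ k k (K + K) (^-cancelʳ-≤ Q 2≤Q (begin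
  Q ^ (k + k)                           ≡⟨ ^-distribˡ-+-* Q k k ⟩
  Q ^ k * Q ^ k                         ≤⟨ *-mono-≤ Qᵏ≤ Qᵏ≤ ⟩
  (N ^ k * Q ^ K) * (N ^ k * Q ^ K)     ≡⟨ *-interchange (N ^ k) (Q ^ K) (N ^ k) (Q ^ K) ⟩
  (N ^ k * N ^ k) * (Q ^ K * Q ^ K)     ≡⟨ cong₂ _*_ (^-distribʳ-* N N k) (^-distribˡ-+-* Q K K) ⟨
  (N * N) ^ k * Q ^ (K + K)             ≤⟨ *-monoˡ-≤ (Q ^ (K + K)) (^-monoˡ-≤ k N²≤Q) ⟩
  Q ^ k * Q ^ (K + K)                   ≡⟨ ^-distribˡ-+-* Q k (K + K) ⟨
  Q ^ (k + (K + K))                     ∎))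
  where open ≤-Reasoning

length≤2P² : ∀ N → 2 ≤ N → ∀ A → InRange N A → ∀ a₀ → ShiftedSubsetSumsSquareFree a₀ A →
             ∀ P → N * N ≤ primorial P → length A ≤ P * P + P * P
length≤2P² N 2≤N A inRange a₀ squarefree P N²≤Q = exponent-bound Q N k K 2≤Q N²≤Q (begin
  Q ^ k                                           ≤⟨ primorial-double-counting A K P few ⟩
  product (map (primeDivisorProduct P) A) * Q ^ K ≤⟨ *-monoˡ-≤ (Q ^ K) (product-primeDivisorProduct≤ N P A inRange) ⟩
  N ^ k * Q ^ K                                   ∎)
  where
  open ≤-Reasoning
  Q = primorial P
  k = length A
  K = P * P
  2≤Q = ≤-trans 2≤N (≤-trans (m≤m*n N N {{>-nonZero (<-trans (s≤s z≤n) 2≤N)}}) N²≤Q)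
  few : ∀ u → u ≤ P → Prime u → length (nonMultiples u A) ≤ K
  few u u≤P pu = ≤-trans (length-nonMultiples≤ a₀ A squarefree pu) (*-mono-≤ u≤P u≤P)

4[2+2ℓ]≤1024ℓ : ∀ ℓ → 1 ≤ ℓ → 4 * (suc ℓ + suc ℓ) ≤ 1024 * ℓ
4[2+2ℓ]≤1024ℓ ℓ 1≤ℓ = begin
  4 * (suc ℓ + suc ℓ)       ≡⟨ expand ℓ ⟩
  8 + 8 * ℓ                 ≤⟨ +-monoˡ-≤ (8 * ℓ) (≤-trans (≤ᵇ⇒≤ 8 1016 _) (m≤m*n 1016 ℓ {{>-nonZero 1≤ℓ}})) ⟩
  1016 * ℓ + 8 * ℓ          ≡⟨ *-distribʳ-+ ℓ 1016 8 ⟨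
  1024 * ℓ                  ∎
  where
  open ≤-Reasoning
  expand : ∀ ℓ → 4 * (suc ℓ + suc ℓ) ≡ 8 + 8 * ℓ
  expand = solve-∀

primorial-exceeds-2^ : ∀ ℓ → 1 ≤ ℓ → ∃ λ P → P ≤ 4096 * ℓ × 2 ^ (suc ℓ + suc ℓ) ≤ primorial P
primorial-exceeds-2^ ℓ 1≤ℓ =
  from-bracket (power-bracket 4 (s≤s (s≤s z≤n)) (1024 * ℓ) {{m*n≢0 1024 ℓ {{_}} {{>-nonZero 1≤ℓ}}}})
  where
  from-bracket : (∃ λ j → 4 ^ j ≤ 1024 * ℓ × 1024 * ℓ < 4 ^ suc j) →
                 ∃ λ P → P ≤ 4096 * ℓ × 2 ^ (suc ℓ + suc ℓ) ≤ primorial P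
  from-bracket (j , 4ʲ≤x , x<4ʲ⁺¹) =
    4 ^ suc j , P≤ , ≤-trans (^-monoʳ-≤ 2 exponent≤) (primorial-lower-bound j 5≤j)
    where
    -- 1024 ℓ ≥ 4⁵ ensures j ≥ 5, as primorial-lower-bound requires.
    5≤j : 5 ≤ j
    5≤j = ≤-pred (^-cancelʳ-< 4 {5} (≤-<-trans (*-monoʳ-≤ 1024 1≤ℓ) x<4ʲ⁺¹))
    P≤ : 4 ^ suc j ≤ 4096 * ℓ
    P≤ = ≤-trans (*-monoʳ-≤ 4 4ʲ≤x) (≤-reflexive (sym (*-assoc 4 1024 ℓ)))
    4[2+2ℓ]≤4ʲ⁺¹ : 4 * (suc ℓ + suc ℓ) ≤ 4 * 4 ^ j
    4[2+2ℓ]≤4ʲ⁺¹ = ≤-trans (4[2+2ℓ]≤1024ℓ ℓ 1≤ℓ) (<⇒≤ x<4ʲ⁺¹)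
    exponent≤ : suc ℓ + suc ℓ ≤ 4 ^ j
    exponent≤ = *-cancelˡ-≤ 4 4[2+2ℓ]≤4ʲ⁺¹

primorial-exceeds-square : ∀ N → 2 ≤ N → ∃ λ P → P ≤ 4096 * ⌊log₂ N ⌋ × N * N ≤ primorial P
primorial-exceeds-square N 2≤N = P , P≤ , (begin
  N * N                                 ≤⟨ *-mono-≤ (<⇒≤ N<2ˡ⁺¹) (<⇒≤ N<2ˡ⁺¹) ⟩
  2 ^ suc ℓ * 2 ^ suc ℓ                 ≡⟨ ^-distribˡ-+-* 2 (suc ℓ) (suc ℓ) ⟨
  2 ^ (suc ℓ + suc ℓ)                   ≤⟨ 2^≤primorial ⟩
  primorial P                           ∎)
  where
  open ≤-Reasoning
  ℓ = ⌊log₂ N ⌋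
  N<2ˡ⁺¹ = proj₂ (log₂-bracket N 2≤N)
  P = proj₁ (primorial-exceeds-2^ ℓ (proj₁ (log₂-bracket N 2≤N)))
  P≤ = proj₁ (proj₂ (primorial-exceeds-2^ ℓ (proj₁ (log₂-bracket N 2≤N))))
  2^≤primorial = proj₂ (proj₂ (primorial-exceeds-2^ ℓ (proj₁ (log₂-bracket N 2≤N))))

2P²≤ : ∀ P c ℓ → P ≤ c * ℓ → P * P + P * P ≤ 2 * c * c * ℓ ^ 2
2P²≤ P c ℓ P≤cℓ = begin
  P * P + P * P                         ≤⟨ +-mono-≤ (*-mono-≤ P≤cℓ P≤cℓ) (*-mono-≤ P≤cℓ P≤cℓ) ⟩
  c * ℓ * (c * ℓ) + c * ℓ * (c * ℓ)     ≡⟨ regroup c ℓ ⟩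
  2 * c * c * (ℓ * ℓ)                   ≡⟨ cong (λ x → 2 * c * c * (ℓ * x)) (*-identityʳ ℓ) ⟨
  2 * c * c * ℓ ^ 2                     ∎
  where
  open ≤-Reasoning
  regroup : ∀ c ℓ → c * ℓ * (c * ℓ) + c * ℓ * (c * ℓ) ≡ 2 * c * c * (ℓ * ℓ)
  regroup = solve-∀

corollary2p16 : Σ ℕ (λ C → ∀ (N : ℕ) → 2 ≤ N → (A : List ℕ) → InRange N A →
    (a₀ : ℕ) → ShiftedSubsetSumsSquareFree a₀ A →
    length A ≤ C * ⌊log₂ N ⌋ ^ 2)
corollary2p16 = 2 * 4096 * 4096 , bound
  where
  bound : ∀ N → 2 ≤ N → ∀ A → InRange N A → ∀ a₀ → ShiftedSubsetSumsSquareFree a₀ A →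
          length A ≤ 2 * 4096 * 4096 * ⌊log₂ N ⌋ ^ 2
  bound N 2≤N A inRange a₀ squarefree =
    let P , P≤ , N²≤primorial = primorial-exceeds-square N 2≤N
    in ≤-trans (length≤2P² N 2≤N A inRange a₀ squarefree P N²≤primorial) (2P²≤ P 4096 ⌊log₂ N ⌋ P≤)
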